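{- Let $q\ge 1$ be an integer and $G$ a finite graph with average degree $d(G)=2|E(G)|/|V(G)|$. Then $\mathrm{OPT}_q(G)\ge \frac{d(G)^2}{2q^2}$.
   Context: An edge $q$-coloring of a graph is an assignment of colors to its edges such that each vertex is incident to edges of at most $q$ distinct colors. A color group is the set of all edges receiving a given color. $\mathrm{OPT}_q(G)$ denotes the minimum, over all edge $q$-colorings of $G$, of the size of the largest color group. -}

module Defs where

open import Data.Nat using (ℕ; _<_; _≤_; _*_; _^_)
open import Data.Nat.Properties using (_≟_)
open import Data.Fin using (Fin; toℕ)
open import Data.Product using (_×_; _,_; proj₁; proj₂; ∃)
open import Data.List using (List; length; filter; lookup)
open import Data.List.Relation.Unary.All using (All)
open import Data.List.Relation.Unary.Unique.Propositional using (Unique)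
open import Data.List.Membership.Propositional using (_∈_)
open import Data.List.Properties using ()
open import Data.Fin.Properties using (all?)
open import Data.List using (allFin)
open import Relation.Binary.PropositionalEquality using (_≡_)
open import Relation.Nullary.Decidable using (Dec)

-- A finite simple graph on the vertex set Fin n: a duplicate-free list of
-- edges, each edge stored as an ordered pair (u , v) with u < v
-- (so no loops and no multiple edges).
record Graph (n : ℕ) : Set where
  field
    edges  : List (Fin n × Fin n)
    proper : All (λ e → toℕ (proj₁ e) < toℕ (proj₂ e)) edges
    nodup  : Unique edges
open Graph public

numEdges : ∀ {n} → Graph n → ℕ
numEdges G = length (edges G)

edge : ∀ {n} (G : Graph n) → Fin (numEdges G) → Fin n × Fin n
edge G i = lookup (edges G) i

IncidentTo : ∀ {n} → Fin n → Fin n × Fin n → Set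
IncidentTo v e = (v ≡ proj₁ e) Data.Sum.⊎ (v ≡ proj₂ e)
  where import Data.Sum

Colouring : ∀ {n} → Graph n → Set
Colouring G = Fin (numEdges G) → ℕ

-- edge q-colouring: every vertex sees at most q distinct colours, i.e. the
-- colours on the edges at v are all contained in some list of at most q colours
IsQColouring : ∀ {n} (q : ℕ) (G : Graph n) → Colouring G → Set
IsQColouring {n} q G c =
  ∀ (v : Fin n) → ∃ λ (cs : List ℕ) → length cs ≤ q ×
    (∀ (i : Fin (numEdges G)) → IncidentTo v (edge G i) → c i ∈ cs)

groupSize : ∀ {n} (G : Graph n) → Colouring G → ℕ → ℕ
groupSize G c k = length (filter (λ i → c i ≟ k) (allFin (numEdges G)))

-- Let colour k have sₖ edges covering aₖ vertices. A simple graph on aₖ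
-- vertices has at most aₖ²/2 edges, so 2sₖ ≤ aₖ², and with S = maxₖ sₖ this
-- gives 2sₖ² ≤ S·aₖ², i.e. √2·sₖ ≤ √S·aₖ. Summing over the colours,
-- √2·m ≤ √S·∑ₖ aₖ, and ∑ₖ aₖ ≤ q·n because each vertex is covered by at most
-- q colours. Squaring yields 2m² ≤ S·q²·n².
module Submission where

open import Defs
open import Data.Nat using (ℕ; suc; _+_; _*_; _^_; _≤_; _<_; z≤n; NonZero)
open import Data.Nat.Properties
open import Algebra.Properties.CommutativeSemigroup +-commutativeSemigroup using () renaming (interchange to +-interchange)
open import Data.Nat.ListAction using (sum)
open import Data.Nat.Tactic.RingSolver using (solve-∀)
open import Data.Fin using (Fin; toℕ)
open import Data.Fin.Properties using (injective⇒≤) renaming (_≟_ to _≟ᶠ_)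
open import Data.Product using (∃; _×_; _,_; proj₁; proj₂; swap)
open import Data.Sum using (inj₁; inj₂)
open import Data.List using (List; []; _∷_; length; map; filter; lookup; _++_; allFin; cartesianProduct; deduplicate)
open import Data.List.Properties using (length-map; length-++; length-tabulate; map-cong; filter-accept; filter-reject; filter-none)
open import Data.List.Extrema.Nat using (argmax; f[xs]≤f[argmax])
open import Data.List.Relation.Unary.All as All using (All; []; _∷_)
open import Data.List.Relation.Unary.Any as Any using (here; there; any?)
open import Data.List.Relation.Unary.Any.Properties using (lookup-index)
open import Data.List.Relation.Unary.Unique.Propositional using (Unique; _∷_)
open import Data.List.Relation.Unary.Unique.Propositional.Properties using (map⁺; ++⁺; filter⁺; allFin⁺)
open import Data.List.Relation.Unary.Unique.DecPropositional.Properties _≟_ using (deduplicate-!)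
open import Data.List.Relation.Binary.Subset.Propositional using (_⊆_)
open import Data.List.Membership.Propositional using (_∈_; find; lose)
open import Data.List.Membership.Propositional.Properties
  using (∈-map⁺; ∈-map⁻; ∈-++⁻; ∈-filter⁺; ∈-filter⁻; ∈-lookup; ∈-allFin; ∈-deduplicate⁺; ∈-cartesianProduct⁺)
open import Data.Empty using (⊥-elim)
open import Function using (_∘_)
open import Function.Definitions using (Injective)
open import Relation.Binary.Definitions using (DecidableEquality)
open import Relation.Binary.PropositionalEquality
open import Relation.Nullary using (Dec; yes; no; ¬_)
open import Relation.Nullary.Decidable using (_⊎-dec_)

private
  variable
    A B : Set

Unique⇒lookup-injective : {xs : List A} → Unique xs → Injective _≡_ _≡_ (lookup xs)
Unique⇒lookup-injective {xs = x ∷ xs} xs!        {Fin.zero}  {Fin.zero}  eq = refl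
Unique⇒lookup-injective {xs = x ∷ xs} (x∉ ∷ xs!) {Fin.zero}  {Fin.suc j} eq = ⊥-elim (All.lookup x∉ (∈-lookup j) eq)
Unique⇒lookup-injective {xs = x ∷ xs} (x∉ ∷ xs!) {Fin.suc i} {Fin.zero}  eq = ⊥-elim (All.lookup x∉ (∈-lookup i) (sym eq))
Unique⇒lookup-injective {xs = x ∷ xs} (x∉ ∷ xs!) {Fin.suc i} {Fin.suc j} eq =
  cong Fin.suc (Unique⇒lookup-injective xs! eq)

Unique⇒⊆⇒length≤ : {xs ys : List A} → Unique xs → xs ⊆ ys → length xs ≤ length ys
Unique⇒⊆⇒length≤ {xs = xs} {ys} xs! xs⊆ys = injective⇒≤ position-injective
  where
  position : Fin (length xs) → Fin (length ys)
  position i = Any.index (xs⊆ys (∈-lookup i))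

  position-injective : Injective _≡_ _≡_ position
  position-injective {i} {j} eq = Unique⇒lookup-injective xs! (begin
    lookup xs i            ≡⟨ lookup-index (xs⊆ys (∈-lookup i)) ⟩
    lookup ys (position i) ≡⟨ cong (lookup ys) eq ⟩
    lookup ys (position j) ≡⟨ lookup-index (xs⊆ys (∈-lookup j)) ⟨
    lookup xs j            ∎)
    where open ≡-Reasoning

length-cartesianProduct : (xs : List A) (ys : List B) →
  length (cartesianProduct xs ys) ≡ length xs * length ys
length-cartesianProduct []       ys = refl
length-cartesianProduct (x ∷ xs) ys = begin
  length (map (x ,_) ys ++ cartesianProduct xs ys)          ≡⟨ length-++ (map (x ,_) ys) ⟩
  length (map (x ,_) ys) + length (cartesianProduct xs ys)  ≡⟨ cong₂ _+_ (length-map (x ,_) ys) (length-cartesianProduct xs ys) ⟩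
  length ys + length xs * length ys                         ∎
  where open ≡-Reasoning

length-filter-≟-Unique : (_≟ₐ_ : DecidableEquality A) {x : A} {xs : List A} →
  Unique xs → x ∈ xs → length (filter (x ≟ₐ_) xs) ≡ 1
length-filter-≟-Unique _≟ₐ_ {x} {x ∷ xs} (x∉ ∷ _) (here refl) = begin
  length (filter (x ≟ₐ_) (x ∷ xs)) ≡⟨ cong length (filter-accept (x ≟ₐ_) refl) ⟩
  suc (length (filter (x ≟ₐ_) xs)) ≡⟨ cong (suc ∘ length) (filter-none (x ≟ₐ_) x∉) ⟩
  1                                 ∎
  where open ≡-Reasoning
length-filter-≟-Unique _≟ₐ_ {x} {y ∷ xs} (y∉ ∷ xs!) (there x∈xs) = begin
  length (filter (x ≟ₐ_) (y ∷ xs)) ≡⟨ cong length (filter-reject (x ≟ₐ_) (λ x≡y → All.lookup y∉ x∈xs (sym x≡y))) ⟩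
  length (filter (x ≟ₐ_) xs)       ≡⟨ length-filter-≟-Unique _≟ₐ_ xs! x∈xs ⟩
  1                                 ∎
  where open ≡-Reasoning

∑ : List A → (A → ℕ) → ℕ
∑ xs f = sum (map f xs)

syntax ∑ xs (λ x → f) = ∑[ x ∈ xs ] f

∑-cong : {f g : A → ℕ} (xs : List A) → (∀ x → f x ≡ g x) → ∑ xs f ≡ ∑ xs g
∑-cong xs f≗g = cong sum (map-cong f≗g xs)

∑-mono-≤ : {f g : A → ℕ} (xs : List A) → (∀ x → f x ≤ g x) → ∑ xs f ≤ ∑ xs g
∑-mono-≤ []       f≤g = z≤n
∑-mono-≤ (x ∷ xs) f≤g = +-mono-≤ (f≤g x) (∑-mono-≤ xs f≤g)

∑-const : (xs : List A) (c : ℕ) → ∑[ _ ∈ xs ] c ≡ c * length xs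
∑-const []       c = sym (*-zeroʳ c)
∑-const (x ∷ xs) c = trans (cong (c +_) (∑-const xs c)) (sym (*-suc c (length xs)))

∑-distrib-+ : (xs : List A) (f g : A → ℕ) → ∑[ x ∈ xs ] (f x + g x) ≡ ∑ xs f + ∑ xs g
∑-distrib-+ []       f g = refl
∑-distrib-+ (x ∷ xs) f g = begin
  f x + g x + ∑[ x ∈ xs ] (f x + g x) ≡⟨ cong (f x + g x +_) (∑-distrib-+ xs f g) ⟩
  f x + g x + (∑ xs f + ∑ xs g)       ≡⟨ +-interchange (f x) (g x) (∑ xs f) (∑ xs g) ⟩
  f x + ∑ xs f + (g x + ∑ xs g)       ∎
  where open ≡-Reasoning

∑-comm : (xs : List A) (ys : List B) (f : A → B → ℕ) →
  ∑[ x ∈ xs ] ∑[ y ∈ ys ] f x y ≡ ∑[ y ∈ ys ] ∑[ x ∈ xs ] f x y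
∑-comm []       ys f = sym (trans (∑-const ys 0) (*-zeroˡ (length ys)))
∑-comm (x ∷ xs) ys f = begin
  ∑[ y ∈ ys ] f x y + ∑[ x ∈ xs ] ∑[ y ∈ ys ] f x y ≡⟨ cong (∑ ys (f x) +_) (∑-comm xs ys f) ⟩
  ∑[ y ∈ ys ] f x y + ∑[ y ∈ ys ] ∑[ x ∈ xs ] f x y ≡⟨ ∑-distrib-+ ys (f x) (λ y → ∑[ x ∈ xs ] f x y) ⟨
  ∑[ y ∈ ys ] (f x y + ∑[ x ∈ xs ] f x y)           ∎
  where open ≡-Reasoning

indicator : {P : Set} → Dec P → ℕ
indicator (yes _) = 1
indicator (no _)  = 0

length-filter : {P : A → Set} (P? : ∀ x → Dec (P x)) (xs : List A) →
  length (filter P? xs) ≡ ∑[ x ∈ xs ] indicator (P? x)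
length-filter P? []       = refl
length-filter P? (x ∷ xs) with P? x
... | yes _ = cong suc (length-filter P? xs)
... | no _  = length-filter P? xs

double-counting : {R : A → B → Set} (R? : ∀ x y → Dec (R x y)) (xs : List A) (ys : List B) →
  ∑[ x ∈ xs ] length (filter (R? x) ys) ≡ ∑[ y ∈ ys ] length (filter (λ x → R? x y) xs)
double-counting R? xs ys = begin
  ∑[ x ∈ xs ] length (filter (R? x) ys)         ≡⟨ ∑-cong xs (λ x → length-filter (R? x) ys) ⟩
  ∑[ x ∈ xs ] ∑[ y ∈ ys ] indicator (R? x y)    ≡⟨ ∑-comm xs ys (λ x y → indicator (R? x y)) ⟩
  ∑[ y ∈ ys ] ∑[ x ∈ xs ] indicator (R? x y)    ≡⟨ ∑-cong ys (λ y → length-filter (λ x → R? x y) xs) ⟨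
  ∑[ y ∈ ys ] length (filter (λ x → R? x y) xs) ∎
  where open ≡-Reasoning

*-self-cancel-≤ : ∀ {m n} → m * m ≤ n * n → m ≤ n
*-self-cancel-≤ m*m≤n*n = ≮⇒≥ (λ n<m → <⇒≱ (*-mono-< n<m n<m) m*m≤n*n)

-- Reading C·b² ≤ D·a² as b ≤ √(D/C)·a, such pairs are closed under addition.
sqBound-+ : ∀ C D a b a′ b′ → C * (b * b) ≤ D * (a * a) → C * (b′ * b′) ≤ D * (a′ * a′) →
  C * ((b + b′) * (b + b′)) ≤ D * ((a + a′) * (a + a′))
sqBound-+ C D a b a′ b′ hb hb′ = begin
  C * ((b + b′) * (b + b′))                              ≡⟨ expand C b b′ ⟩
  C * (b * b) + 2 * (C * (b * b′)) + C * (b′ * b′)       ≤⟨ +-mono-≤ (+-mono-≤ hb (*-monoʳ-≤ 2 cross)) hb′ ⟩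
  D * (a * a) + 2 * (D * (a * a′)) + D * (a′ * a′)       ≡⟨ expand D a a′ ⟨
  D * ((a + a′) * (a + a′))                              ∎
  where
  open ≤-Reasoning
  expand : ∀ C x y → C * ((x + y) * (x + y)) ≡ C * (x * x) + 2 * (C * (x * y)) + C * (y * y)
  expand = solve-∀
  regroup : ∀ C x y → C * (x * y) * (C * (x * y)) ≡ C * (x * x) * (C * (y * y))
  regroup = solve-∀
  cross : C * (b * b′) ≤ D * (a * a′)
  cross = *-self-cancel-≤ (begin
    C * (b * b′) * (C * (b * b′))   ≡⟨ regroup C b b′ ⟩
    C * (b * b) * (C * (b′ * b′))   ≤⟨ *-mono-≤ hb hb′ ⟩
    D * (a * a) * (D * (a′ * a′))   ≡⟨ regroup D a a′ ⟨
    D * (a * a′) * (D * (a * a′))   ∎)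

sqBound-∑ : ∀ C D (xs : List A) {a b : A → ℕ} →
  All (λ x → C * (b x * b x) ≤ D * (a x * a x)) xs →
  C * (∑ xs b * ∑ xs b) ≤ D * (∑ xs a * ∑ xs a)
sqBound-∑ C D []       []         = ≤-reflexive (trans (*-zeroʳ C) (sym (*-zeroʳ D)))
sqBound-∑ C D (x ∷ xs) {a} {b} (hx ∷ hxs) = sqBound-+ C D (a x) (b x) (∑ xs a) (∑ xs b) hx (sqBound-∑ C D xs hxs)

Ordered : {n : ℕ} → Fin n × Fin n → Set
Ordered e = toℕ (proj₁ e) < toℕ (proj₂ e)

incident? : {n : ℕ} (v : Fin n) (e : Fin n × Fin n) → Dec (IncidentTo v e)
incident? v e = (v ≟ᶠ proj₁ e) ⊎-dec (v ≟ᶠ proj₂ e)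

coveredVertices : {n : ℕ} → List (Fin n × Fin n) → List (Fin n)
coveredVertices {n} es = filter (λ v → any? (incident? v) es) (allFin n)

∈-coveredVertices : {n : ℕ} {es : List (Fin n × Fin n)} {e : Fin n × Fin n} {v : Fin n} →
  e ∈ es → IncidentTo v e → v ∈ coveredVertices es
∈-coveredVertices {v = v} e∈es v∈e = ∈-filter⁺ _ (∈-allFin v) (lose e∈es v∈e)

-- Both orientations of the edges are distinct pairs of covered vertices.
twice-length≤covered² : {n : ℕ} {es : List (Fin n × Fin n)} → Unique es → All Ordered es →
  2 * length es ≤ length (coveredVertices es) * length (coveredVertices es)
twice-length≤covered² {es = es} es! ordered = begin
  2 * length es                                ≡⟨ cong (length es +_) (+-identityʳ (length es)) ⟩
  length es + length es                        ≡⟨ cong (length es +_) (length-map swap es) ⟨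
  length es + length (map swap es)             ≡⟨ length-++ es ⟨
  length (es ++ map swap es)                   ≤⟨ Unique⇒⊆⇒length≤ both! both⊆ ⟩
  length (cartesianProduct covered covered)    ≡⟨ length-cartesianProduct covered covered ⟩
  length covered * length covered              ∎
  where
  open ≤-Reasoning
  covered : List (Fin _)
  covered = coveredVertices es

  disjoint : ∀ {e} → ¬ (e ∈ es × e ∈ map swap es)
  disjoint (e∈es , e∈swapped) with ∈-map⁻ swap e∈swapped
  ... | e′ , e′∈es , refl = <-asym (All.lookup ordered e′∈es) (All.lookup ordered e∈es)

  both! : Unique (es ++ map swap es)
  both! = ++⁺ es! (map⁺ (cong swap) es!) disjoint

  both⊆ : es ++ map swap es ⊆ cartesianProduct covered covered
  both⊆ e∈both with ∈-++⁻ es e∈both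
  ... | inj₁ e∈es = ∈-cartesianProduct⁺ (∈-coveredVertices e∈es (inj₁ refl)) (∈-coveredVertices e∈es (inj₂ refl))
  ... | inj₂ e∈swapped with ∈-map⁻ swap e∈swapped
  ... | e′ , e′∈es , refl = ∈-cartesianProduct⁺ (∈-coveredVertices e′∈es (inj₂ refl)) (∈-coveredVertices e′∈es (inj₁ refl))

module _ {n : ℕ} (G : Graph n) (c : Colouring G) where

  colourClass : ℕ → List (Fin n × Fin n)
  colourClass k = map (edge G) (filter (λ i → c i ≟ k) (allFin (numEdges G)))

  colours : List ℕ
  colours = deduplicate _≟_ (map c (allFin (numEdges G)))

  colours-Unique : Unique colours
  colours-Unique = deduplicate-! (map c (allFin (numEdges G)))

  ∈-colourClass⁻ : ∀ {k e} → e ∈ colourClass k → ∃ λ i → c i ≡ k × e ≡ edge G i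
  ∈-colourClass⁻ {k} e∈class with ∈-map⁻ (edge G) e∈class
  ... | i , i∈filter , refl = i , proj₂ (∈-filter⁻ (λ i → c i ≟ k) {xs = allFin (numEdges G)} i∈filter) , refl

  colourClass-Unique : ∀ k → Unique (colourClass k)
  colourClass-Unique k = map⁺ (Unique⇒lookup-injective (nodup G)) (filter⁺ (λ i → c i ≟ k) (allFin⁺ (numEdges G)))

  colourClass-ordered : ∀ k → All Ordered (colourClass k)
  colourClass-ordered k = All.tabulate ordered
    where
    ordered : ∀ {e} → e ∈ colourClass k → Ordered e
    ordered e∈class with ∈-colourClass⁻ e∈class
    ... | i , _ , refl = All.lookup (proper G) (∈-lookup i)

  classOrder : ℕ → ℕ
  classOrder k = length (coveredVertices (colourClass k))

  twice-groupSize≤classOrder² : ∀ k → 2 * groupSize G c k ≤ classOrder k * classOrder k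
  twice-groupSize≤classOrder² k = begin
    2 * groupSize G c k          ≡⟨ cong (2 *_) (length-map (edge G) (filter (λ i → c i ≟ k) (allFin (numEdges G)))) ⟨
    2 * length (colourClass k)   ≤⟨ twice-length≤covered² (colourClass-Unique k) (colourClass-ordered k) ⟩
    classOrder k * classOrder k  ∎
    where open ≤-Reasoning

  ∑-groupSize : ∑[ k ∈ colours ] groupSize G c k ≡ numEdges G
  ∑-groupSize = begin
    ∑[ k ∈ colours ] groupSize G c k                       ≡⟨ double-counting (λ k i → c i ≟ k) colours edgeIndices ⟩
    ∑[ i ∈ edgeIndices ] length (filter (c i ≟_) colours)  ≡⟨ ∑-cong edgeIndices (λ i → length-filter-≟-Unique _≟_ colours-Unique (∈-colours i)) ⟩
    ∑[ i ∈ edgeIndices ] 1                                 ≡⟨ ∑-const edgeIndices 1 ⟩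
    1 * length edgeIndices                                 ≡⟨ *-identityˡ _ ⟩
    length edgeIndices                                     ≡⟨ length-tabulate (λ i → i) ⟩
    numEdges G                                             ∎
    where
    open ≡-Reasoning
    edgeIndices : List (Fin (numEdges G))
    edgeIndices = allFin (numEdges G)
    ∈-colours : ∀ i → c i ∈ colours
    ∈-colours i = ∈-deduplicate⁺ _≟_ (∈-map⁺ c (∈-allFin i))

  ∑-classOrder≤ : ∀ {q} → IsQColouring q G c → ∑ colours classOrder ≤ q * n
  ∑-classOrder≤ {q} q-colouring = begin
    ∑ colours classOrder                      ≡⟨ double-counting (λ k v → any? (incident? v) (colourClass k)) colours (allFin n) ⟩
    ∑[ v ∈ allFin n ] length (coloursAt v)    ≤⟨ ∑-mono-≤ (allFin n) coloursAt≤q ⟩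
    ∑[ v ∈ allFin n ] q                       ≡⟨ ∑-const (allFin n) q ⟩
    q * length (allFin n)                     ≡⟨ cong (q *_) (length-tabulate (λ v → v)) ⟩
    q * n                                     ∎
    where
    open ≤-Reasoning
    coloursAt : Fin n → List ℕ
    coloursAt v = filter (λ k → any? (incident? v) (colourClass k)) colours

    coloursAt≤q : ∀ v → length (coloursAt v) ≤ q
    coloursAt≤q v with q-colouring v
    ... | cs , |cs|≤q , colours-at-v∈cs = ≤-trans (Unique⇒⊆⇒length≤ (filter⁺ _ colours-Unique) coloursAt⊆cs) |cs|≤q
      where
      coloursAt⊆cs : coloursAt v ⊆ cs
      coloursAt⊆cs k∈ with find (proj₂ (∈-filter⁻ (λ k → any? (incident? v) (colourClass k)) {xs = colours} k∈))
      ... | e , e∈class , v∈e with ∈-colourClass⁻ e∈class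
      ... | i , refl , refl = colours-at-v∈cs i v∈e

theorem8 : (q n : ℕ) → .{{NonZero q}} → .{{NonZero n}} → (G : Graph n)
    → (c : Colouring G) → IsQColouring q G c
    → ∃ λ (k : ℕ) → 2 * numEdges G ^ 2 ≤ q ^ 2 * n ^ 2 * groupSize G c k
theorem8 q n G c q-colouring = largest , (begin
  2 * numEdges G ^ 2              ≡⟨ cong (2 *_) (square (numEdges G)) ⟩
  2 * (numEdges G * numEdges G)   ≡⟨ cong (λ m → 2 * (m * m)) (∑-groupSize G c) ⟨
  2 * (∑ K s * ∑ K s)             ≤⟨ sqBound-∑ 2 S K (All.map sqBound (f[xs]≤f[argmax] 0 K)) ⟩
  S * (∑ K a * ∑ K a)             ≤⟨ *-monoʳ-≤ S (*-mono-≤ ∑a≤qn ∑a≤qn) ⟩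
  S * (q * n * (q * n))           ≡⟨ regroup q n S ⟩
  q * q * (n * n) * S             ≡⟨ cong₂ (λ x y → x * y * S) (square q) (square n) ⟨
  q ^ 2 * n ^ 2 * S               ∎)
  where
  open ≤-Reasoning
  s a : ℕ → ℕ
  s = groupSize G c
  a = classOrder G c
  K : List ℕ
  K = colours G c
  largest S : ℕ
  largest = argmax s 0 K
  S = s largest

  ∑a≤qn : ∑ K a ≤ q * n
  ∑a≤qn = ∑-classOrder≤ G c q-colouring

  sqBound : ∀ {k} → s k ≤ S → 2 * (s k * s k) ≤ S * (a k * a k)
  sqBound {k} sₖ≤S = begin
    2 * (s k * s k)  ≡⟨ *-assoc 2 (s k) (s k) ⟨
    2 * s k * s k    ≤⟨ *-mono-≤ (twice-groupSize≤classOrder² G c k) sₖ≤S ⟩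
    a k * a k * S    ≡⟨ *-comm (a k * a k) S ⟩
    S * (a k * a k)  ∎

  square : ∀ x → x ^ 2 ≡ x * x
  square x = cong (x *_) (*-identityʳ x)

  regroup : ∀ q n S → S * (q * n * (q * n)) ≡ q * q * (n * n) * S
  regroup = solve-∀
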